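{- In a $(v,[k_1,k_2,k_3],\lambda)$ Hadamard partitioned difference family, the block sizes $k_1$ and $k_2$ are, in some order, the two numbers $$\frac{2\lambda-k_3\pm\sqrt{2\lambda(2k_3+1)-3k_3^2}}{2}.$$
   Context: Groups are finite, written additively (not necessarily abelian). For $B\subseteq G$, $\Delta B=\{x-y: x,y\in B, x\neq y\}$ as a multiset. A $(v,[k_1,\dots,k_t],\lambda)$ partitioned difference family (PDF) is a partition of a group $G$ of order $v$ into blocks $B_1,\dots,B_t$ with $|B_i|=k_i$ such that the multiset union of the $\Delta B_i$ covers every non-zero element of $G$ exactly $\lambda$ times. It is Hadamard (HPDF) if $v=2\lambda$. -}

module Defs where

open import Data.Nat using (ℕ; zero; suc; _+_; _*_)
open import Data.Fin using (Fin)
open import Data.Fin.Properties using (_≟_)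
open import Data.List using (List; map; allFin)
open import Data.Nat.ListAction using (sum)
open import Data.Bool using (Bool; true; false; if_then_else_; _∧_; not)
open import Relation.Nullary.Decidable using (⌊_⌋)
open import Relation.Nullary using (¬_)
open import Relation.Binary.PropositionalEquality using (_≡_)
open import Algebra.Core using (Op₁; Op₂)
open import Algebra.Structures using (IsGroup)

count : ∀ {n} → (Fin n → Bool) → ℕ
count {n} p = sum (map (λ i → if p i then 1 else 0) (allFin n))

-- A finite group of order v, written additively (not necessarily abelian),
-- realised on the carrier Fin v (every group of order v is isomorphic to one such).
record FiniteGroup (v : ℕ) : Set where
  field
    _⊕_     : Op₂ (Fin v)
    zero#   : Fin v
    neg     : Op₁ (Fin v)
    isGroup : IsGroup _≡_ _⊕_ zero# neg

  _⊖_ : Fin v → Fin v → Fin v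
  x ⊖ y = x ⊕ neg y

open FiniteGroup public

-- An (ordered) partition of G into t blocks B₀,…,B_{t-1} is given by the
-- block-assignment map blk : G → Fin t, with B_i = blk⁻¹(i).
blockSize : ∀ {v t} → (Fin v → Fin t) → Fin t → ℕ
blockSize blk i = count (λ x → ⌊ blk x ≟ i ⌋)

-- Multiplicity of g in the multiset union of the ΔB_i:
-- number of ordered pairs (x,y) with x ≠ y, x,y in a common block, x - y = g.
diffMult : ∀ {v t} → FiniteGroup v → (Fin v → Fin t) → Fin v → ℕ
diffMult {v} G blk g =
  sum (map (λ x → count (λ y →
         not ⌊ x ≟ y ⌋ ∧ ⌊ blk x ≟ blk y ⌋ ∧ ⌊ _⊖_ G x y ≟ g ⌋))
       (allFin v))

record IsPDF {v t : ℕ} (G : FiniteGroup v) (blk : Fin v → Fin t)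
             (k : Fin t → ℕ) (lam : ℕ) : Set where
  field
    sizes  : ∀ i → blockSize blk i ≡ k i
    covers : ∀ g → ¬ (g ≡ zero# G) → diffMult G blk g ≡ lam

record IsHPDF {v t : ℕ} (G : FiniteGroup v) (blk : Fin v → Fin t)
              (k : Fin t → ℕ) (lam : ℕ) : Set where
  field
    isPDF    : IsPDF G blk k lam
    hadamard : v ≡ 2 * lam

module Submission where

-- Double counting the ordered pairs (x , y) with x ≠ y in a common block: each non-zero
-- difference occurs λ times and 0 never does, so Σ kᵢ(kᵢ - 1) = λ(v - 1), while Σ kᵢ = v.
-- With v = 2λ this gives k₁ + k₂ = 2λ - k₃ and k₁² + k₂² = 2λ² + λ - k₃², hence
-- (k₁ - k₂)² = 2(k₁² + k₂²) - (k₁ + k₂)² = 2λ(2k₃ + 1) - 3k₃², and k₁, k₂ = (k₁ + k₂ ± |k₁ - k₂|) / 2.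

open import Defs
open import Data.Fin using (Fin)
open import Relation.Binary.PropositionalEquality using (_≡_; refl; sym; trans; cong; cong₂; module ≡-Reasoning)

module DoubleCounting where
  open import Algebra.Bundles using (Group)
  import Algebra.Properties.Group as GroupProperties
  open import Data.Bool using (Bool; true; false; if_then_else_; _∧_; not)
  open import Data.Bool.Properties using (∧-assoc; ∧-zeroʳ)
  open import Data.Fin using (zero; suc; punchIn)
  open import Data.Fin.Patterns using (0F; 1F; 2F)
  open import Data.Fin.Properties using (_≟_; punchInᵢ≢i)
  import Data.List as List using (map; tabulate; allFin)
  open import Data.List.Properties using (map-tabulate)
  import Data.Nat.ListAction as List
  open import Data.Nat using (ℕ; zero; suc; _+_; _*_)
  open import Data.Nat.Properties
    using (+-*-semiring; +-commutativeSemigroup; +-identityʳ; +-assoc; +-comm; *-identityʳ; +-cancelʳ-≡)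
  open import Data.Nat.Tactic.RingSolver using (solve-∀)
  open import Algebra.Properties.CommutativeSemigroup +-commutativeSemigroup using (xy∙z≈xz∙y)
  open import Data.Product using (_×_; _,_)
  open import Algebra.Properties.Semiring.Sum +-*-semiring
    using (sum-syntax; sum-cong-≗; sum-replicate-zero; sum-remove; ∑-comm; ∑-distrib-+; *-distribʳ-sum)
  open import Function using (_∘_; id; mk⇔)
  open import Relation.Binary.PropositionalEquality using (_≢_)
  open import Relation.Nullary.Decidable using (⌊_⌋; yes; no; dec-true; does-⇔; isYes≗does; ⌊⌋-map′)

  [_] : Bool → ℕ
  [ b ] = if b then 1 else 0

  sum-tabulate : ∀ {n} (f : Fin n → ℕ) → List.sum (List.tabulate f) ≡ ∑[ i < n ] f i
  sum-tabulate {zero}  f = refl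
  sum-tabulate {suc n} f = cong (f zero +_) (sum-tabulate (f ∘ suc))

  sum-map-allFin : ∀ {n} (f : Fin n → ℕ) → List.sum (List.map f (List.allFin n)) ≡ ∑[ i < n ] f i
  sum-map-allFin f = trans (cong List.sum (map-tabulate id f)) (sum-tabulate f)

  count≡∑ : ∀ {n} (p : Fin n → Bool) → count p ≡ ∑[ i < n ] [ p i ]
  count≡∑ p = sum-map-allFin (λ i → [ p i ])

  blockSize≡∑ : ∀ {v t} (blk : Fin v → Fin t) i → blockSize blk i ≡ ∑[ x < v ] [ ⌊ blk x ≟ i ⌋ ]
  blockSize≡∑ blk i = count≡∑ (λ x → ⌊ blk x ≟ i ⌋)

  ∑-const : ∀ n c → ∑[ i < n ] c ≡ n * c
  ∑-const zero    c = refl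
  ∑-const (suc n) c = cong (c +_) (∑-const n c)

  ∑₃ : ∀ (f : Fin 3 → ℕ) → ∑[ i < 3 ] f i ≡ f 0F + f 1F + f 2F
  ∑₃ f = trans (sym (+-assoc (f 0F) (f 1F) (f 2F + 0))) (cong (f 0F + f 1F +_) (+-identityʳ (f 2F)))

  ∑-select : ∀ {n} (i : Fin n) (f : Fin n → ℕ) → ∑[ j < n ] ([ ⌊ i ≟ j ⌋ ] * f j) ≡ f i
  ∑-select {suc n} zero    f =
    trans (cong₂ _+_ (+-identityʳ (f zero)) (sum-replicate-zero n)) (+-identityʳ (f zero))
  ∑-select {suc n} (suc i) f =
    trans (sum-cong-≗ (λ j → cong (λ b → [ b ] * f (suc j)) (⌊⌋-map′ _ _ (i ≟ j)))) (∑-select i (f ∘ suc))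

  ∑-δ : ∀ {n} (i : Fin n) → ∑[ j < n ] [ ⌊ i ≟ j ⌋ ] ≡ 1
  ∑-δ i = trans (sum-cong-≗ (λ j → sym (*-identityʳ [ ⌊ i ≟ j ⌋ ]))) (∑-select i (λ _ → 1))

  ∑-δ-∧ : ∀ {n} (b : Bool) (i : Fin n) → ∑[ j < n ] [ b ∧ ⌊ i ≟ j ⌋ ] ≡ [ b ]
  ∑-δ-∧ {n} false i = sum-replicate-zero n
  ∑-δ-∧     true  i = ∑-δ i

  ∑-const-except : ∀ {n} (f : Fin n → ℕ) (i : Fin n) c → (∀ j → j ≢ i → f j ≡ c) →
                   ∑[ j < n ] f j + c ≡ f i + n * c
  ∑-const-except {suc n} f i c others = begin
    ∑[ j < suc n ] f j + c               ≡⟨ cong (_+ c) (sum-remove {i = i} f) ⟩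
    f i + ∑[ j < n ] f (punchIn i j) + c ≡⟨ cong (λ s → f i + s + c) ∑-others ⟩
    f i + n * c + c                      ≡⟨ +-assoc (f i) (n * c) c ⟩
    f i + (n * c + c)                    ≡⟨ cong (f i +_) (+-comm (n * c) c) ⟩
    f i + suc n * c                      ∎
    where
    open ≡-Reasoning
    ∑-others : ∑[ j < n ] f (punchIn i j) ≡ n * c
    ∑-others = trans (sum-cong-≗ (λ j → others (punchIn i j) (punchInᵢ≢i i j))) (∑-const n c)

  ⌊≟⌋-refl : ∀ {n} (i : Fin n) → ⌊ i ≟ i ⌋ ≡ true
  ⌊≟⌋-refl i = trans (isYes≗does (i ≟ i)) (dec-true (i ≟ i) refl)

  ⌊≟⌋-sym : ∀ {n} (i j : Fin n) → ⌊ i ≟ j ⌋ ≡ ⌊ j ≟ i ⌋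
  ⌊≟⌋-sym i j =
    trans (isYes≗does (i ≟ j)) (trans (does-⇔ (mk⇔ sym sym) (i ≟ j) (j ≟ i)) (sym (isYes≗does (j ≟ i))))

  ∑-fibres : ∀ {v t} (blk : Fin v → Fin t) (f : Fin t → ℕ) →
             ∑[ x < v ] f (blk x) ≡ ∑[ i < t ] (blockSize blk i * f i)
  ∑-fibres {v} {t} blk f = begin
    ∑[ x < v ] f (blk x)                            ≡⟨ sum-cong-≗ (λ x → ∑-select (blk x) f) ⟨
    ∑[ x < v ] ∑[ i < t ] ([ ⌊ blk x ≟ i ⌋ ] * f i) ≡⟨ ∑-comm (λ x i → [ ⌊ blk x ≟ i ⌋ ] * f i) ⟩
    ∑[ i < t ] ∑[ x < v ] ([ ⌊ blk x ≟ i ⌋ ] * f i) ≡⟨ sum-cong-≗ (λ i → *-distribʳ-sum (f i) (λ x → [ ⌊ blk x ≟ i ⌋ ])) ⟨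
    ∑[ i < t ] (∑[ x < v ] [ ⌊ blk x ≟ i ⌋ ] * f i) ≡⟨ sum-cong-≗ (λ i → cong (_* f i) (blockSize≡∑ blk i)) ⟨
    ∑[ i < t ] (blockSize blk i * f i)              ∎
    where open ≡-Reasoning

  module Partition {v t} (blk : Fin v → Fin t) where

    sameBlockPair : Fin v → Fin v → Bool
    sameBlockPair x y = not ⌊ x ≟ y ⌋ ∧ ⌊ blk x ≟ blk y ⌋

    partners : Fin v → ℕ
    partners x = ∑[ y < v ] [ sameBlockPair x y ]

    pairs : ℕ
    pairs = ∑[ x < v ] partners x

    ∑-blockSize : ∑[ i < t ] blockSize blk i ≡ v
    ∑-blockSize = begin
      ∑[ i < t ] blockSize blk i       ≡⟨ sum-cong-≗ (λ i → *-identityʳ (blockSize blk i)) ⟨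
      ∑[ i < t ] (blockSize blk i * 1) ≡⟨ ∑-fibres blk (λ _ → 1) ⟨
      ∑[ x < v ] 1                     ≡⟨ ∑-const v 1 ⟩
      v * 1                            ≡⟨ *-identityʳ v ⟩
      v                                ∎
      where open ≡-Reasoning

    partners-suc : ∀ x → partners x + 1 ≡ blockSize blk (blk x)
    partners-suc x = begin
      partners x + 1                                     ≡⟨ cong (partners x +_) (∑-δ x) ⟨
      partners x + ∑[ y < v ] [ ⌊ x ≟ y ⌋ ]              ≡⟨ ∑-distrib-+ (λ y → [ sameBlockPair x y ]) (λ y → [ ⌊ x ≟ y ⌋ ]) ⟨
      ∑[ y < v ] ([ sameBlockPair x y ] + [ ⌊ x ≟ y ⌋ ]) ≡⟨ sum-cong-≗ same-block ⟩
      ∑[ y < v ] [ ⌊ blk y ≟ blk x ⌋ ]                   ≡⟨ blockSize≡∑ blk (blk x) ⟨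
      blockSize blk (blk x)                              ∎
      where
      open ≡-Reasoning
      same-block : ∀ y → [ sameBlockPair x y ] + [ ⌊ x ≟ y ⌋ ] ≡ [ ⌊ blk y ≟ blk x ⌋ ]
      same-block y with x ≟ y
      ... | yes refl = cong [_] (sym (⌊≟⌋-refl (blk x)))
      ... | no _     = trans (+-identityʳ _) (cong [_] (⌊≟⌋-sym (blk x) (blk y)))

    ∑-blockSize² : pairs + v ≡ ∑[ i < t ] (blockSize blk i * blockSize blk i)
    ∑-blockSize² = begin
      pairs + v                                      ≡⟨ cong (pairs +_) (trans (∑-const v 1) (*-identityʳ v)) ⟨
      pairs + ∑[ x < v ] 1                           ≡⟨ ∑-distrib-+ partners (λ _ → 1) ⟨
      ∑[ x < v ] (partners x + 1)                    ≡⟨ sum-cong-≗ partners-suc ⟩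
      ∑[ x < v ] blockSize blk (blk x)               ≡⟨ ∑-fibres blk (blockSize blk) ⟩
      ∑[ i < t ] (blockSize blk i * blockSize blk i) ∎
      where open ≡-Reasoning

  module Differences {v t} (G : FiniteGroup v) (blk : Fin v → Fin t) where
    open Partition blk

    _−_ : Fin v → Fin v → Fin v
    _−_ = _⊖_ G

    group : Group _ _
    group = record { isGroup = isGroup G }

    open GroupProperties group using (x∙y⁻¹≈ε⇒x≈y)

    diffMult≡∑ : ∀ g → diffMult G blk g ≡ ∑[ x < v ] ∑[ y < v ] [ sameBlockPair x y ∧ ⌊ x − y ≟ g ⌋ ]
    diffMult≡∑ g = begin
      diffMult G blk g                                            ≡⟨ sum-map-allFin (λ x → count (p x)) ⟩
      ∑[ x < v ] count (p x)                                      ≡⟨ sum-cong-≗ (λ x → count≡∑ (p x)) ⟩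
      ∑[ x < v ] ∑[ y < v ] [ p x y ]                             ≡⟨ sum-cong-≗ (λ x → sum-cong-≗ (λ y → cong [_] (reassociate x y))) ⟩
      ∑[ x < v ] ∑[ y < v ] [ sameBlockPair x y ∧ ⌊ x − y ≟ g ⌋ ] ∎
      where
      open ≡-Reasoning
      p : Fin v → Fin v → Bool
      p x y = not ⌊ x ≟ y ⌋ ∧ ⌊ blk x ≟ blk y ⌋ ∧ ⌊ x − y ≟ g ⌋
      reassociate : ∀ x y → p x y ≡ sameBlockPair x y ∧ ⌊ x − y ≟ g ⌋
      reassociate x y = sym (∧-assoc (not ⌊ x ≟ y ⌋) ⌊ blk x ≟ blk y ⌋ ⌊ x − y ≟ g ⌋)

    ∑-diffMult : ∑[ g < v ] diffMult G blk g ≡ pairs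
    ∑-diffMult = begin
      ∑[ g < v ] diffMult G blk g                  ≡⟨ sum-cong-≗ diffMult≡∑ ⟩
      ∑[ g < v ] ∑[ x < v ] ∑[ y < v ] [ d g x y ] ≡⟨ ∑-comm (λ g x → ∑[ y < v ] [ d g x y ]) ⟩
      ∑[ x < v ] ∑[ g < v ] ∑[ y < v ] [ d g x y ] ≡⟨ sum-cong-≗ (λ x → ∑-comm (λ g y → [ d g x y ])) ⟩
      ∑[ x < v ] ∑[ y < v ] ∑[ g < v ] [ d g x y ] ≡⟨ sum-cong-≗ (λ x → sum-cong-≗ (λ y → ∑-δ-∧ (sameBlockPair x y) (x − y))) ⟩
      pairs                                        ∎
      where
      open ≡-Reasoning
      d : Fin v → Fin v → Fin v → Bool
      d g x y = sameBlockPair x y ∧ ⌊ x − y ≟ g ⌋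

    diffMult-zero : diffMult G blk (zero# G) ≡ 0
    diffMult-zero = begin
      diffMult G blk (zero# G)                                          ≡⟨ diffMult≡∑ (zero# G) ⟩
      ∑[ x < v ] ∑[ y < v ] [ sameBlockPair x y ∧ ⌊ x − y ≟ zero# G ⌋ ] ≡⟨ sum-cong-≗ no-zero-differences ⟩
      ∑[ x < v ] 0                                                      ≡⟨ sum-replicate-zero v ⟩
      0                                                                 ∎
      where
      open ≡-Reasoning
      no-zero-difference : ∀ x y → [ sameBlockPair x y ∧ ⌊ x − y ≟ zero# G ⌋ ] ≡ 0
      no-zero-difference x y with x − y ≟ zero# G
      ... | no _ = cong [_] (∧-zeroʳ (sameBlockPair x y))
      ... | yes x−y≡0 with refl ← x∙y⁻¹≈ε⇒x≈y x y x−y≡0 =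
        cong (λ b → [ (not b ∧ ⌊ blk x ≟ blk x ⌋) ∧ true ]) (⌊≟⌋-refl x)
      no-zero-differences : ∀ x → ∑[ y < v ] [ sameBlockPair x y ∧ ⌊ x − y ≟ zero# G ⌋ ] ≡ 0
      no-zero-differences x = trans (sum-cong-≗ (no-zero-difference x)) (sum-replicate-zero v)

  pdf-power-sums : ∀ {v t} {G : FiniteGroup v} {blk : Fin v → Fin t} {k : Fin t → ℕ} {l} →
                   IsPDF G blk k l →
                   ∑[ i < t ] k i ≡ v × ∑[ i < t ] (k i * k i) + l ≡ v * l + v
  pdf-power-sums {v} {t} {G} {blk} {k} {l} pdf = ∑-k , ∑-k²
    where
    open ≡-Reasoning
    open IsPDF pdf
    open Partition blk
    open Differences G blk

    ∑-k : ∑[ i < t ] k i ≡ v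
    ∑-k = trans (sum-cong-≗ (λ i → sym (sizes i))) ∑-blockSize

    ∑-k² : ∑[ i < t ] (k i * k i) + l ≡ v * l + v
    ∑-k² = begin
      ∑[ i < t ] (k i * k i) + l                         ≡⟨ cong (_+ l) (sum-cong-≗ (λ i → cong₂ _*_ (sizes i) (sizes i))) ⟨
      ∑[ i < t ] (blockSize blk i * blockSize blk i) + l ≡⟨ cong (_+ l) ∑-blockSize² ⟨
      pairs + v + l                                      ≡⟨ xy∙z≈xz∙y pairs v l ⟩
      pairs + l + v                                      ≡⟨ cong (λ n → n + l + v) ∑-diffMult ⟨
      ∑[ g < v ] diffMult G blk g + l + v                ≡⟨ cong (_+ v) (∑-const-except (diffMult G blk) (zero# G) l covers) ⟩
      diffMult G blk (zero# G) + v * l + v               ≡⟨ cong (λ n → n + v * l + v) diffMult-zero ⟩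
      v * l + v                                          ∎

  hpdf-power-sums : ∀ {v t} {G : FiniteGroup v} {blk : Fin v → Fin t} {k : Fin t → ℕ} {l} →
                    IsHPDF G blk k l →
                    ∑[ i < t ] k i ≡ 2 * l × ∑[ i < t ] (k i * k i) ≡ 2 * l * l + l
  hpdf-power-sums {t = t} {k = k} {l} record { isPDF = pdf ; hadamard = refl }
    with ∑-k , ∑-k² ← pdf-power-sums pdf =
    ∑-k , +-cancelʳ-≡ l (∑[ i < t ] (k i * k i)) (2 * l * l + l) (trans ∑-k² (regroup l))
    where
    regroup : ∀ l → 2 * l * l + 2 * l ≡ 2 * l * l + l + l
    regroup = solve-∀

open import Data.Nat using (ℕ)
open import Data.Vec using (_∷_; []; lookup)
open import Data.Integer using (ℤ; +_; _+_; _-_; _*_)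
open import Data.Product using (_×_; ∃-syntax)
open import Data.Sum using (_⊎_)

import Data.Nat as ℕ
import Data.Nat.Properties as ℕ
open DoubleCounting using (hpdf-power-sums; ∑₃)
open import Data.Integer.Properties using (pos-+; pos-*)
open import Data.Integer.Tactic.RingSolver using (solve-∀)
open import Data.Product using (_,_; map₂)
open import Data.Sum using (inj₁; inj₂)

subtractʳ : ∀ {i j k : ℤ} → i + j ≡ k → i ≡ k - j
subtractʳ {i} {j} refl = i≡i+j-j i j
  where
  i≡i+j-j : ∀ i j → i ≡ i + j - j
  i≡i+j-j = solve-∀

pair-from-power-sums : ∀ (a b c l s : ℤ) → a ≡ b + s → a + b + c ≡ + 2 * l →
  a * a + b * b + c * c ≡ + 2 * l * l + l →
  (s * s ≡ + 2 * l * (+ 2 * c + + 1) - + 3 * c * c) × (+ 2 * a ≡ + 2 * l - c + s) × (+ 2 * b ≡ + 2 * l - c - s)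
pair-from-power-sums .(b + s) b c l s refl sum sum² = s² , 2a , 2b
  where
  open ≡-Reasoning
  a : ℤ
  a = b + s
  a+b : a + b ≡ + 2 * l - c
  a+b = subtractʳ sum
  a²+b² : a * a + b * b ≡ + 2 * l * l + l - c * c
  a²+b² = subtractʳ sum²

  s² : s * s ≡ + 2 * l * (+ 2 * c + + 1) - + 3 * c * c
  s² = begin
    s * s                                                           ≡⟨ difference² b s ⟩
    + 2 * (a * a + b * b) - (a + b) * (a + b)                       ≡⟨ cong₂ (λ q p → + 2 * q - p * p) a²+b² a+b ⟩
    + 2 * (+ 2 * l * l + l - c * c) - (+ 2 * l - c) * (+ 2 * l - c) ≡⟨ expand l c ⟩
    + 2 * l * (+ 2 * c + + 1) - + 3 * c * c                         ∎
    where
    difference² : ∀ b s → s * s ≡ + 2 * ((b + s) * (b + s) + b * b) - (b + s + b) * (b + s + b)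
    difference² = solve-∀
    expand : ∀ l c → + 2 * (+ 2 * l * l + l - c * c) - (+ 2 * l - c) * (+ 2 * l - c) ≡ + 2 * l * (+ 2 * c + + 1) - + 3 * c * c
    expand = solve-∀

  2a : + 2 * a ≡ + 2 * l - c + s
  2a = begin
    + 2 * a         ≡⟨ twice b s ⟩
    a + b + s       ≡⟨ cong (_+ s) a+b ⟩
    + 2 * l - c + s ∎
    where
    twice : ∀ b s → + 2 * (b + s) ≡ b + s + b + s
    twice = solve-∀

  2b : + 2 * b ≡ + 2 * l - c - s
  2b = begin
    + 2 * b         ≡⟨ twice b s ⟩
    a + b - s       ≡⟨ cong (_- s) a+b ⟩
    + 2 * l - c - s ∎
    where
    twice : ∀ b s → + 2 * b ≡ b + s + b - s
    twice = solve-∀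

pos-+₃ : ∀ x y z → + (x ℕ.+ y ℕ.+ z) ≡ + x + + y + + z
pos-+₃ x y z = trans (pos-+ (x ℕ.+ y) z) (cong (_+ + z) (pos-+ x y))

ordered-pair-from-power-sums : ∀ {a b} c l → b ℕ.≤ a →
  a ℕ.+ b ℕ.+ c ≡ 2 ℕ.* l → a ℕ.* a ℕ.+ b ℕ.* b ℕ.+ c ℕ.* c ≡ 2 ℕ.* l ℕ.* l ℕ.+ l →
  let s = a ℕ.∸ b in
  (+ s * + s ≡ + 2 * + l * (+ 2 * + c + + 1) - + 3 * + c * + c)
    × (+ 2 * + a ≡ + 2 * + l - + c + + s) × (+ 2 * + b ≡ + 2 * + l - + c - + s)
ordered-pair-from-power-sums {a} {b} c l b≤a sum sum² =
  pair-from-power-sums (+ a) (+ b) (+ c) (+ l) (+ (a ℕ.∸ b)) a≡b+s sumℤ sum²ℤ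
  where
  open ≡-Reasoning
  a≡b+s : + a ≡ + b + + (a ℕ.∸ b)
  a≡b+s = trans (cong +_ (sym (ℕ.m+[n∸m]≡n b≤a))) (pos-+ b (a ℕ.∸ b))
  sumℤ : + a + + b + + c ≡ + 2 * + l
  sumℤ = begin
    + a + + b + + c   ≡⟨ pos-+₃ a b c ⟨
    + (a ℕ.+ b ℕ.+ c) ≡⟨ cong +_ sum ⟩
    + (2 ℕ.* l)       ≡⟨ pos-* 2 l ⟩
    + 2 * + l         ∎
  sum²ℤ : + a * + a + + b * + b + + c * + c ≡ + 2 * + l * + l + + l
  sum²ℤ = begin
    + a * + a + + b * + b + + c * + c       ≡⟨ cong₂ _+_ (cong₂ _+_ (pos-* a a) (pos-* b b)) (pos-* c c) ⟨
    + (a ℕ.* a) + + (b ℕ.* b) + + (c ℕ.* c) ≡⟨ pos-+₃ (a ℕ.* a) (b ℕ.* b) (c ℕ.* c) ⟨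
    + (a ℕ.* a ℕ.+ b ℕ.* b ℕ.+ c ℕ.* c)     ≡⟨ cong +_ sum² ⟩
    + (2 ℕ.* l ℕ.* l ℕ.+ l)                 ≡⟨ pos-+ (2 ℕ.* l ℕ.* l) l ⟩
    + (2 ℕ.* l ℕ.* l) + + l                 ≡⟨ cong (_+ + l) (trans (pos-* (2 ℕ.* l) l) (cong (_* + l) (pos-* 2 l))) ⟩
    + 2 * + l * + l + + l                   ∎

block-sizes-from-power-sums : ∀ a b c l →
  a ℕ.+ b ℕ.+ c ≡ 2 ℕ.* l → a ℕ.* a ℕ.+ b ℕ.* b ℕ.+ c ℕ.* c ≡ 2 ℕ.* l ℕ.* l ℕ.+ l →
  ∃[ s ] ((+ s * + s ≡ + 2 * + l * (+ 2 * + c + + 1) - + 3 * + c * + c)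
    × (((+ 2 * + a ≡ + 2 * + l - + c + + s) × (+ 2 * + b ≡ + 2 * + l - + c - + s))
      ⊎ ((+ 2 * + b ≡ + 2 * + l - + c + + s) × (+ 2 * + a ≡ + 2 * + l - + c - + s))))
block-sizes-from-power-sums a b c l sum sum² with ℕ.≤-total b a
... | inj₁ b≤a = a ℕ.∸ b , map₂ inj₁ (ordered-pair-from-power-sums c l b≤a sum sum²)
... | inj₂ a≤b = b ℕ.∸ a , map₂ inj₂ (ordered-pair-from-power-sums c l a≤b
  (trans (cong (ℕ._+ c) (ℕ.+-comm b a)) sum) (trans (cong (ℕ._+ c ℕ.* c) (ℕ.+-comm (b ℕ.* b) (a ℕ.* a))) sum²))

proposition3p2 : (v k₁ k₂ k₃ l : ℕ) (G : FiniteGroup v) (blk : Fin v → Fin 3) →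
    IsHPDF G blk (lookup (k₁ ∷ k₂ ∷ k₃ ∷ [])) l →
    ∃[ s ] ((+ s * + s ≡ + 2 * + l * (+ 2 * + k₃ + + 1) - + 3 * + k₃ * + k₃)
      × (((+ 2 * + k₁ ≡ + 2 * + l - + k₃ + + s) × (+ 2 * + k₂ ≡ + 2 * + l - + k₃ - + s))
        ⊎ ((+ 2 * + k₂ ≡ + 2 * + l - + k₃ + + s) × (+ 2 * + k₁ ≡ + 2 * + l - + k₃ - + s))))
proposition3p2 v k₁ k₂ k₃ l G blk hpdf with ∑-k , ∑-k² ← hpdf-power-sums hpdf =
  block-sizes-from-power-sums k₁ k₂ k₃ l
    (trans (sym (∑₃ k)) ∑-k) (trans (sym (∑₃ (λ i → k i ℕ.* k i))) ∑-k²)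
  where
  k : Fin 3 → ℕ
  k = lookup (k₁ ∷ k₂ ∷ k₃ ∷ [])
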